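{- Let $C$ be a set and $\prec$ a Lehmann hyper-order on $C$. Let $D$ be the set of elements $c\in C$ such that $\{c\}$ is insignificant, and for $A\subseteq C$ set $L(A)=D\cup\{c\in C:\{c\}\prec A\}$. If $A,B\subseteq C$ satisfy $A\subseteq L(A)\cup B$, then $L(A)\subseteq L(B)$.
   Context: A hyper-relation on $C$ is a binary relation $\prec$ on the set of subsets of $C$. A set $B\subseteq C$ is essential if $\emptyset\prec B$ and insignificant otherwise. A Lehmann hyper-order is a hyper-relation satisfying: (L0) irreflexivity; (L1) if $A'\subseteq A\prec B$ then $A'\prec B$; (L2) if $(A_i)_{i\in I}$ is a nonempty family with $A_i\prec B$ for all $i$, then $\bigcup_iA_i\prec B$; (L3) if $A\prec B\subseteq B'$ then $A\prec B'$; (L4) if $A\prec A\cup B$ then $A\prec B$; (L5) if $A$ is essential and $B$ is insignificant then $B\prec A$. -}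

module Defs where

open import Level using (0ℓ)
open import Data.Product using (Σ)
open import Data.Sum using (_⊎_)
open import Relation.Nullary using (¬_)
open import Relation.Unary using (Pred; _⊆_; _∪_; ∅; ｛_｝; ⋃)

HyperRel : Set → Set₁
HyperRel C = Pred C 0ℓ → Pred C 0ℓ → Set

module _ {C : Set} (_≺_ : HyperRel C) where

  Essential : Pred C 0ℓ → Set
  Essential B = ∅ ≺ B

  Insignificant : Pred C 0ℓ → Set
  Insignificant B = ¬ (∅ ≺ B)

  record IsLehmannHyperOrder : Set₁ where
    field
      L0 : ∀ A → ¬ (A ≺ A)
      L1 : ∀ {A' A B} → A' ⊆ A → A ≺ B → A' ≺ B
      L2 : ∀ {I : Set} (Ai : I → Pred C 0ℓ) {B} → I →
           (∀ i → Ai i ≺ B) → ⋃ I Ai ≺ B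
      L3 : ∀ {A B B'} → A ≺ B → B ⊆ B' → A ≺ B'
      L4 : ∀ {A B} → A ≺ (A ∪ B) → A ≺ B
      L5 : ∀ {A B} → Essential A → Insignificant B → B ≺ A

  D : Pred C 0ℓ
  D c = Insignificant ｛ c ｝

  L : Pred C 0ℓ → Pred C 0ℓ
  L A = D ∪ (λ c → ｛ c ｝ ≺ A)

-- Write S(A) = {c | {c} ≺ A}, so that L(A) = D ∪ S(A). By (L2) a set is
-- below an essential B as soon as each of its singletons is; hence S(A) ≺ A,
-- and, using (L5), D ≺ B for every essential B. From A ⊆ S(A) ∪ (D ∪ B),
-- (L3) and (L4) give S(A) ≺ D ∪ B, so D ∪ B is essential and
-- L(A) = D ∪ S(A) ≺ D ∪ B; one more application of (L4) yields L(A) ≺ B,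
-- and (L1) passes this down to every singleton of L(A).
module Submission where

open import Defs
open import Level using (0ℓ)
open import Relation.Unary using (Pred; _⊆_; _∪_; ∅; ｛_｝)
open import Data.Product using (Σ; _,_)
open import Data.Sum using (inj₁; inj₂; [_,_])
open import Data.Bool using (Bool; true; false)
open import Data.Maybe using (Maybe; just; nothing)
open import Relation.Binary.PropositionalEquality using (refl)

module LehmannHyperOrderProperties
  {C : Set} {_≺_ : HyperRel C} (H : IsLehmannHyperOrder _≺_) where

  open IsLehmannHyperOrder H

  ≺⇒essential : ∀ {A B} → A ≺ B → Essential _≺_ B
  ≺⇒essential = L1 λ ()

  ∪-≺ : ∀ {A A' B} → A ≺ B → A' ≺ B → (A ∪ A') ≺ B
  ∪-≺ {A} {A'} {B} A≺B A'≺B =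
    L1 [ (λ a → true , a) , (λ a' → false , a') ] (L2 family true family≺)
    where
    family : Bool → Pred C 0ℓ
    family true  = A
    family false = A'
    family≺ : ∀ i → family i ≺ B
    family≺ true  = A≺B
    family≺ false = A'≺B

  ≺-cancel : ∀ {A B B'} → A ≺ B → B ⊆ A ∪ B' → A ≺ B'
  ≺-cancel A≺B B⊆A∪B' = L4 (L3 A≺B B⊆A∪B')

  -- The empty set is added to the family so that (L2) applies even when X is empty.
  singletons-≺ : ∀ {X B} → Essential _≺_ B →
                 (∀ {c} → X c → ｛ c ｝ ≺ B) → X ≺ B
  singletons-≺ {X} {B} essB pointwise =
    L1 (λ {c} x → just (c , x) , refl) (L2 family nothing family≺)
    where
    family : Maybe (Σ C X) → Pred C 0ℓ
    family nothing        = ∅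
    family (just (c , _)) = ｛ c ｝
    family≺ : ∀ i → family i ≺ B
    family≺ nothing        = essB
    family≺ (just (_ , x)) = pointwise x

  D-≺ : ∀ {B} → Essential _≺_ B → D _≺_ ≺ B
  D-≺ essB = singletons-≺ essB (L5 essB)

  L-≺ : ∀ {A B} → Essential _≺_ A → A ⊆ L _≺_ A ∪ B → L _≺_ A ≺ B
  L-≺ {A} {B} essA A⊆LA∪B = ≺-cancel (∪-≺ (D-≺ essD∪B) S≺D∪B) reassociate
    where
    S : Pred C 0ℓ
    S c = ｛ c ｝ ≺ A
    S≺D∪B : S ≺ (D _≺_ ∪ B)
    S≺D∪B = ≺-cancel (singletons-≺ essA (λ s → s))
      λ a → [ [ (λ d → inj₂ (inj₁ d)) , inj₁ ] , (λ b → inj₂ (inj₂ b)) ] (A⊆LA∪B a)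
    essD∪B : Essential _≺_ (D _≺_ ∪ B)
    essD∪B = ≺⇒essential S≺D∪B
    reassociate : D _≺_ ∪ B ⊆ L _≺_ A ∪ B
    reassociate = [ (λ d → inj₁ (inj₁ d)) , inj₂ ]

lemmaA2 : {C : Set} (_≺_ : HyperRel C) → IsLehmannHyperOrder _≺_ →
          (A B : Pred C 0ℓ) → A ⊆ (L _≺_ A ∪ B) → L _≺_ A ⊆ L _≺_ B
lemmaA2 _≺_ H A B A⊆LA∪B (inj₁ d) = inj₁ d
lemmaA2 _≺_ H A B A⊆LA∪B {c} (inj₂ c≺A) =
  inj₂ (L1 (λ { refl → inj₂ c≺A }) (L-≺ (≺⇒essential c≺A) A⊆LA∪B))
  where
  open IsLehmannHyperOrder H
  open LehmannHyperOrderProperties H
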